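{- For $0\le i,j\le D$, the matrices $A_iA_j^*+A_j^*A_i$ and $A_iA_j^*-A_j^*A_i$ are orthogonal, and $$\|A_iA_j^*+A_j^*A_i\|^2=2|X|k_im_j(1+u_i(\theta_j)),\qquad \|A_iA_j^*-A_j^*A_i\|^2=2|X|k_im_j(1-u_i(\theta_j)),$$ where $\|B\|^2=\langle B,B\rangle$.
   Context: Let $\Gamma=(X,\mathcal E)$ be a finite connected undirected distance-regular graph (no loops or multiple edges) with distance $\partial$ and diameter $D\ge3$; $p^h_{ij}=|\{w:\partial(y,w)=i,\partial(z,w)=j\}|$ for $\partial(y,z)=h$ is independent of $y,z$; $k_i=p^0_{ii}$, $k=k_1$, $c_i=p^i_{1,i-1}$, $a_i=p^i_{1,i}$, $b_i=p^i_{1,i+1}$. On complex matrices indexed by $X$ use $\langle R,S\rangle=\mathrm{tr}(R^t\overline S)$. $A_i$ is the $i$-th distance matrix ($(A_i)_{yz}=1$ iff $\partial(y,z)=i$), $A=A_1$. $E_0,\dots,E_D$ are the primitive idempotents of $M=\mathrm{Span}(A_0,\dots,A_D)$ (real symmetric, $E_iE_j=\delta_{ij}E_i$, $\sum E_i=I$, $E_0=|X|^{ -1}J$), $m_i=\mathrm{rank}(E_i)$, $\theta_i$ the eigenvalue with $AE_i=\theta_iE_i$. Polynomials $u_0=1$, $u_1=\lambda/k$, $\lambda u_i=c_iu_{i-1}+a_iu_i+b_iu_{i+1}$ ($1\le i\le D-1$). Fix $x\in X$; $A_i^*$ is the diagonal matrix with $(A_i^*)_{yy}=|X|(E_i)_{xy}$.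 -}

module Defs where

open import Level using (Level; _⊔_)
open import Algebra.Bundles using (CommutativeRing)
open import Data.Nat as ℕ using (ℕ; zero; suc; _≤_; _∸_)
open import Data.Fin as Fin using (Fin; toℕ)
open import Data.Bool using (Bool; true; false; _∨_; _∧_; if_then_else_)
open import Data.List using (List; length; filter)
open import Data.Bool.ListAction using (any)
open import Data.Fin.Base using () renaming (zero to fzero)
open import Data.Product using (Σ; ∃; ∃-syntax; _×_; _,_)
open import Relation.Nullary using (¬_)
open import Relation.Binary.PropositionalEquality using (_≡_)
open import Data.Nat.Properties using () renaming (_≟_ to _≟ℕ_)
open import Relation.Nullary.Decidable using (⌊_⌋)
import Data.List as List

allV : (n : ℕ) → List (Fin n)
allV n = List.allFin n

reach : {n : ℕ} → (Fin n → Fin n → Bool) → ℕ → Fin n → Fin n → Bool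
reach {n} adj zero    y z = ⌊ y Fin.≟ z ⌋
reach {n} adj (suc k) y z = reach adj k y z ∨ any (λ w → adj y w ∧ reach adj k w z) (allV n)

-- least k < bound with reach k y z (returns bound if none)
firstReach : {n : ℕ} → (Fin n → Fin n → Bool) → ℕ → ℕ → Fin n → Fin n → ℕ
firstReach adj k zero      y z = k
firstReach adj k (suc fuel) y z =
  if reach adj k y z then k else firstReach adj (suc k) fuel y z

-- graph distance ∂(y,z): length of a shortest walk (= n if unreachable;
-- excluded below by connectivity, since shortest walks have length < n).
dist : {n : ℕ} → (Fin n → Fin n → Bool) → Fin n → Fin n → ℕ
dist {n} adj y z = firstReach adj 0 n y z

pcount : {n : ℕ} → (Fin n → Fin n → Bool) → Fin n → Fin n → ℕ → ℕ → ℕ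
pcount {n} adj y z i j =
  length (filter (λ w → (dist adj y w ≟ℕ i) Relation.Nullary.×-dec (dist adj z w ≟ℕ j)) (allV n))
  where import Relation.Nullary

-- A finite connected distance-regular graph with diameter D and
-- intersection numbers p h i j = p^h_{ij}.
record IsDRG (n : ℕ) (adj : Fin n → Fin n → Bool) (D : ℕ) (p : ℕ → ℕ → ℕ → ℕ) : Set where
  field
    symmetric   : ∀ y z → adj y z ≡ adj z y
    loopless    : ∀ y → adj y y ≡ false
    connected   : ∀ y z → ∃[ k ] reach adj k y z ≡ true
    diam-bound  : ∀ y z → dist adj y z ≤ D
    diam-attain : ∃[ y ] ∃[ z ] dist adj y z ≡ D
    regular     : ∀ y z i j → pcount adj y z i j ≡ p (dist adj y z) i j

kk : (ℕ → ℕ → ℕ → ℕ) → ℕ → ℕ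
kk p i = p 0 i i
cc aa bb : (ℕ → ℕ → ℕ → ℕ) → ℕ → ℕ
cc p i = p i 1 (i ∸ 1)
aa p i = p i 1 i
bb p i = p i 1 (suc i)

-- Linear algebra over a commutative ring R (used with R a field of
-- characteristic zero, standing in for ℝ).

module LinAlg {c ℓ : Level} (R : CommutativeRing c ℓ) where
  open CommutativeRing R

  -- a field of characteristic 0 (inverse given as a total function,
  -- specified on nonzero elements)
  fromℕ : ℕ → Carrier
  fromℕ zero    = 0#
  fromℕ (suc m) = 1# + fromℕ m

  record FieldChar0 : Set (c ⊔ ℓ) where
    field
      inv      : Carrier → Carrier
      inv-law  : ∀ x → ¬ (x ≈ 0#) → x * inv x ≈ 1#
      char0    : ∀ m → ¬ (fromℕ (suc m) ≈ 0#)

  Σ[_] : (m : ℕ) → (Fin m → Carrier) → Carrier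
  Σ[ zero  ] f = 0#
  Σ[ suc m ] f = f fzero + Σ[ m ] (λ k → f (Fin.suc k))

  Mat : ℕ → Set c
  Mat n = Fin n → Fin n → Carrier

  _·_ : {n : ℕ} → Mat n → Mat n → Mat n
  _·_ {n} P Q y z = Σ[ n ] (λ w → P y w * Q w z)

  _⊕_ _⊖_ : {n : ℕ} → Mat n → Mat n → Mat n
  (P ⊕ Q) y z = P y z + Q y z
  (P ⊖ Q) y z = P y z - Q y z

  _⋆_ : {n : ℕ} → Carrier → Mat n → Mat n
  (a ⋆ P) y z = a * P y z

  _ᵗ : {n : ℕ} → Mat n → Mat n
  (P ᵗ) y z = P z y

  tr : {n : ℕ} → Mat n → Carrier
  tr {n} P = Σ[ n ] (λ y → P y y)

  -- ⟨R,S⟩ = tr(Rᵗ S̄); all matrices here are real, so conjugation is trivial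
  ⟨_,_⟩ : {n : ℕ} → Mat n → Mat n → Carrier
  ⟨ P , Q ⟩ = tr ((P ᵗ) · Q)

  ‖_‖² : {n : ℕ} → Mat n → Carrier
  ‖ P ‖² = ⟨ P , P ⟩

  _≈M_ : {n : ℕ} → Mat n → Mat n → Set ℓ
  P ≈M Q = ∀ y z → P y z ≈ Q y z

  𝟘 𝕀 𝕁 : {n : ℕ} → Mat n
  𝟘 y z = 0#
  𝕀 y z = if ⌊ y Fin.≟ z ⌋ then 1# else 0#
  𝕁 y z = 1#

  diag : {n : ℕ} → (Fin n → Carrier) → Mat n
  diag d y z = if ⌊ y Fin.≟ z ⌋ then d y else 0#

  -- rank: the column space has a basis consisting of r of the columns
  LinIndep : {n r : ℕ} → (Fin r → Fin n → Carrier) → Set (c ⊔ ℓ)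
  LinIndep {n} {r} v =
    ∀ (α : Fin r → Carrier) → (∀ y → Σ[ r ] (λ t → α t * v t y) ≈ 0#) → ∀ t → α t ≈ 0#

  InSpan : {n r : ℕ} → (Fin r → Fin n → Carrier) → (Fin n → Carrier) → Set (c ⊔ ℓ)
  InSpan {n} {r} v u = Σ (Fin r → Carrier) λ α → (∀ y → u y ≈ Σ[ r ] (λ t → α t * v t y))

  HasRank : {n : ℕ} → Mat n → ℕ → Set (c ⊔ ℓ)
  HasRank {n} P r =
    Σ (Fin r → Fin n) λ sel → (LinIndep {n} {r} (λ t y → P y (sel t))
             × (∀ z → InSpan {n} {r} (λ t y → P y (sel t)) (λ y → P y z)))

  distMat : {n : ℕ} → (Fin n → Fin n → Bool) → ℕ → Mat n
  distMat adj i y z = if ⌊ dist adj y z ≟ℕ i ⌋ then 1# else 0#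

  uPoly : FieldChar0 → (ℕ → ℕ → ℕ → ℕ) → ℕ → Carrier → Carrier
  uPoly F p zero          λ' = 1#
  uPoly F p (suc zero)    λ' = λ' * FieldChar0.inv F (fromℕ (kk p 1))
  uPoly F p (suc (suc i)) λ' =
    ((λ' - fromℕ (aa p (suc i))) * uPoly F p (suc i) λ'
       - fromℕ (cc p (suc i)) * uPoly F p i λ')
    * FieldChar0.inv F (fromℕ (bb p (suc i)))

  -- E 0, …, E D are the primitive idempotents of the Bose–Mesner algebra
  -- M = Span(A_0,…,A_D), with eigenvalues θ (A E_i = θ_i E_i).
  record PrimIdem (F : FieldChar0) (n : ℕ) (adj : Fin n → Fin n → Bool) (D : ℕ)
                  (E : Fin (suc D) → Mat n) (θ : Fin (suc D) → Carrier) : Set (c ⊔ ℓ) where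
    field
      inM       : ∀ i → Σ (Fin (suc D) → Carrier) λ α → (E i ≈M (λ y z → Σ[ suc D ] (λ h → α h * distMat adj (toℕ h) y z)))
      symm      : ∀ i → E i ≈M (E i ᵗ)
      nonzero   : ∀ i → ¬ (E i ≈M 𝟘)
      idem      : ∀ i → (E i · E i) ≈M E i
      orth      : ∀ i j → ¬ (i ≡ j) → (E i · E j) ≈M 𝟘
      sumI      : (λ y z → Σ[ suc D ] (λ i → E i y z)) ≈M 𝕀
      E0        : E fzero ≈M (FieldChar0.inv F (fromℕ n) ⋆ 𝕁)
      eigen     : ∀ i → (distMat adj 1 · E i) ≈M (θ i ⋆ E i)

  dualMat : {n D : ℕ} → (Fin (suc D) → Mat n) → Fin n → Fin (suc D) → Mat n
  dualMat {n} E x j = diag (λ y → fromℕ n * E j x y)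

-- Put L = A_i A*_j and L′ = A*_j A_i.  By polarization of the
-- symmetric bilinear trace form it suffices to show
--   ‖L‖² = ‖L′‖² = k_i |X| m_j   and   ⟨L,L′⟩ = k_i |X| m_j u_i(θ_j).
-- A*_j is diagonal with entries d_y = |X| (E_j)_xy, so L and L′ are A_i with
-- its columns, resp. rows, scaled by d, and L′ = Lᵗ.  Using the column sums
-- k_i of A_i and E_j² = E_j, ‖L‖² = k_i Σ_y d_y² = k_i |X|² (E_j)_xx, and
-- |X| (E_j)_xx = tr E_j = m_j because the trace of an idempotent is its rank.
-- Similarly ⟨L,L′⟩ = |X|² (E_j A_i E_j)_xx = |X|² k_i · (value of E_j at
-- distance i), and that value is (E_j)_xx u_i(θ_j) by the three-term
-- recurrence which A E_j = θ_j E_j imposes on the entries of E_j.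

module Submission where

open import Defs
open import Level using (Level)
open import Algebra.Bundles using (CommutativeRing)
open import Data.Nat using (ℕ; suc; _≤_)
open import Data.Fin using (Fin; toℕ)
open import Data.Bool using (Bool)
open import Data.Product using (_×_)

open import Data.Nat as ℕ using (zero; s≤s; z≤n)
open import Data.Fin as Fin using ()
open import Data.Fin.Properties using (suc-injective)
open import Data.Bool using (true; false; if_then_else_)
open import Data.Product using (∃-syntax; _,_; proj₁; proj₂)
open import Data.List using (List; _∷_; length; filter; tabulate)
open import Data.Empty using (⊥-elim)
open import Function using (_∘_; id)
open import Relation.Nullary using (Dec; yes; no; ¬_; _×-dec_)
open import Relation.Nullary.Decidable using (⌊_⌋)
open import Relation.Unary using (Pred; Decidable)
open import Relation.Binary.PropositionalEquality as ≡ using (_≡_; _≢_)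

-- Identities in a commutative ring

module Scalars {c ℓ : Level} (R : CommutativeRing c ℓ) where
  open CommutativeRing R
  open LinAlg R using (fromℕ; FieldChar0)
  open import Relation.Binary.Reasoning.Setoid setoid
  open import Algebra.Solver.Ring.NaturalCoefficients.Default commutativeSemiring
    using (solve; _:+_; _:*_; _:=_)
  open import Algebra.Properties.Ring ring using (x[y-z]≈xy-xz; [y-z]x≈yx-zx)
  open import Algebra.Properties.AbelianGroup +-abelianGroup using (⁻¹-anti-homo‿-; ⁻¹-∙-comm)

  fromℕ-2 : fromℕ 2 ≈ 1# + 1#
  fromℕ-2 = +-congˡ (+-identityʳ 1#)

  -- The additive-group identities telescope, difference-of-differences and
  -- cancel-two are proved by rearranging with the commutative-semiring
  -- solver, treating negatives as variables, and cancelling x against - x.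
  telescope : ∀ a s b → (a - s) + (s - b) ≈ a - b
  telescope a s b = begin
    (a - s) + (s - b)  ≈⟨ solve 4 (λ a s s' b' → (a :+ s') :+ (s :+ b') := (a :+ b') :+ (s :+ s')) refl a s (- s) (- b) ⟩
    (a - b) + (s - s)  ≈⟨ +-congˡ (-‿inverseʳ s) ⟩
    (a - b) + 0#       ≈⟨ +-identityʳ _ ⟩
    a - b              ∎

  difference-of-differences : ∀ a s b → (a - s) - (s - b) ≈ (a + b) - (s + s)
  difference-of-differences a s b = begin
    (a - s) - (s - b)      ≈⟨ +-congˡ (⁻¹-anti-homo‿- s b) ⟩
    (a - s) + (b - s)      ≈⟨ solve 4 (λ a s' b s'' → (a :+ s') :+ (b :+ s'') := (a :+ b) :+ (s' :+ s'')) refl a (- s) b (- s) ⟩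
    (a + b) + (- s - s)    ≈⟨ +-congˡ (⁻¹-∙-comm s s) ⟩
    (a + b) - (s + s)      ∎

  cancel-two : ∀ a b c → ((c + (a + b)) - a) - c ≈ b
  cancel-two a b c = begin
    ((c + (a + b)) - a) - c   ≈⟨ solve 5 (λ a b c a' c' → ((c :+ (a :+ b)) :+ a') :+ c' := b :+ ((a :+ a') :+ (c :+ c'))) refl a b c (- a) (- c) ⟩
    b + ((a - a) + (c - c))   ≈⟨ +-congˡ (+-cong (-‿inverseʳ a) (-‿inverseʳ c)) ⟩
    b + (0# + 0#)             ≈⟨ +-congˡ (+-identityʳ 0#) ⟩
    b + 0#                    ≈⟨ +-identityʳ b ⟩
    b                         ∎

  difference-of-squares : ∀ a b → (a + b) * (a - b) ≈ a * a - b * b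
  difference-of-squares a b = begin
    (a + b) * (a - b)              ≈⟨ distribʳ (a - b) a b ⟩
    a * (a - b) + b * (a - b)      ≈⟨ +-cong (x[y-z]≈xy-xz a a b) (x[y-z]≈xy-xz b a b) ⟩
    (a * a - a * b) + (b * a - b * b) ≈⟨ +-congˡ (+-congʳ (*-comm b a)) ⟩
    (a * a - a * b) + (a * b - b * b) ≈⟨ telescope (a * a) (a * b) (b * b) ⟩
    a * a - b * b                  ∎

  square-of-sum : ∀ a b → (a + b) * (a + b) ≈ (a * a + b * b) + (a * b + a * b)
  square-of-sum = solve 2 (λ a b → (a :+ b) :* (a :+ b) := (a :* a :+ b :* b) :+ (a :* b :+ a :* b)) refl

  square-of-difference : ∀ a b → (a - b) * (a - b) ≈ (a * a + b * b) - (a * b + a * b)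
  square-of-difference a b = begin
    (a - b) * (a - b)                  ≈⟨ [y-z]x≈yx-zx (a - b) a b ⟩
    a * (a - b) - b * (a - b)          ≈⟨ +-cong (x[y-z]≈xy-xz a a b) (-‿cong (x[y-z]≈xy-xz b a b)) ⟩
    (a * a - a * b) - (b * a - b * b)  ≈⟨ +-congˡ (-‿cong (+-congʳ (*-comm b a))) ⟩
    (a * a - a * b) - (a * b - b * b)  ≈⟨ difference-of-differences (a * a) (a * b) (b * b) ⟩
    (a * a + b * b) - (a * b + a * b)  ∎

  three-term-step : ∀ {t a b c v₀ v₁ v₂ w u₀ u₁} →
    t * v₁ ≈ c * v₀ + (a * v₁ + b * v₂) → v₀ ≈ w * u₀ → v₁ ≈ w * u₁ →
    b * v₂ ≈ w * ((t - a) * u₁ - c * u₀)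
  three-term-step {t} {a} {b} {c} {v₀} {v₁} {v₂} {w} {u₀} {u₁} relation v₀≈ v₁≈ = sym (begin
    w * ((t - a) * u₁ - c * u₀)                 ≈⟨ x[y-z]≈xy-xz w _ _ ⟩
    w * ((t - a) * u₁) - w * (c * u₀)           ≈⟨ +-cong (solve 3 (λ w s u → w :* (s :* u) := s :* (w :* u)) refl w (t - a) u₁)
                                                          (-‿cong (solve 3 (λ w c u → w :* (c :* u) := c :* (w :* u)) refl w c u₀)) ⟩
    (t - a) * (w * u₁) - c * (w * u₀)           ≈⟨ +-cong (*-congˡ (sym v₁≈)) (-‿cong (*-congˡ (sym v₀≈))) ⟩
    (t - a) * v₁ - c * v₀                       ≈⟨ +-congʳ ([y-z]x≈yx-zx v₁ t a) ⟩
    (t * v₁ - a * v₁) - c * v₀                  ≈⟨ +-congʳ (+-congʳ relation) ⟩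
    ((c * v₀ + (a * v₁ + b * v₂)) - a * v₁) - c * v₀ ≈⟨ cancel-two (a * v₁) (b * v₂) (c * v₀) ⟩
    b * v₂                                      ∎)

  divide : ∀ {a x y} a' → a * a' ≈ 1# → a * x ≈ y → x ≈ y * a'
  divide {a} {x} {y} a' inverse ax≈y = begin
    x              ≈⟨ *-identityʳ x ⟨
    x * 1#         ≈⟨ *-congˡ inverse ⟨
    x * (a * a')   ≈⟨ solve 3 (λ x a a' → x :* (a :* a') := (a :* x) :* a') refl x a a' ⟩
    (a * x) * a'   ≈⟨ *-congʳ ax≈y ⟩
    y * a'         ∎

  fromℕ-invertible : (F : FieldChar0) → ∀ {k} → 1 ≤ k → fromℕ k * FieldChar0.inv F (fromℕ k) ≈ 1#
  fromℕ-invertible F {suc k} _ = FieldChar0.inv-law F (fromℕ (suc k)) (FieldChar0.char0 F k)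

  ι : Bool → Carrier
  ι b = if b then 1# else 0#

  ι-idem : ∀ b → ι b * ι b ≈ ι b
  ι-idem true  = *-identityˡ 1#
  ι-idem false = zeroˡ 0#

  ι-× : ∀ {p q} {P : Set p} {Q : Set q} (P? : Dec P) (Q? : Dec Q) →
        ι ⌊ P? ×-dec Q? ⌋ ≈ ι ⌊ P? ⌋ * ι ⌊ Q? ⌋
  ι-× (yes _) (yes _) = sym (*-identityˡ 1#)
  ι-× (yes _) (no _)  = sym (zeroʳ 1#)
  ι-× (no _)  _       = sym (zeroˡ _)

  if-yes : ∀ {p} {P : Set p} (P? : Dec P) {a} → P → (if ⌊ P? ⌋ then a else 0#) ≈ a
  if-yes (yes _) _  = refl
  if-yes (no ¬p) p = ⊥-elim (¬p p)

  if-no : ∀ {p} {P : Set p} (P? : Dec P) {a} → ¬ P → (if ⌊ P? ⌋ then a else 0#) ≈ 0#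
  if-no (yes p) ¬p = ⊥-elim (¬p p)
  if-no (no _)  _  = refl

  ι-support : ∀ {p} {P : Set p} (P? : Dec P) {f g} → (P → f ≈ g) → ι ⌊ P? ⌋ * f ≈ ι ⌊ P? ⌋ * g
  ι-support (yes p) f≈g = *-congˡ (f≈g p)
  ι-support (no _)  _   = trans (zeroˡ _) (sym (zeroˡ _))

-- Finite sums  Σ[ m ] f  (defined by recursion in Defs), related to the
-- library's  sum  so that its lemmas can be reused.

module FiniteSums {c ℓ : Level} (R : CommutativeRing c ℓ) where
  open CommutativeRing R
  open LinAlg R using (fromℕ; Σ[_])
  open Scalars R using (ι; if-yes; if-no)
  open import Algebra.Properties.Semiring.Sum semiring
    using (sum; sum-cong-≋; sum-cong-≗; ∑-distrib-+; ∑-comm; *-distribˡ-sum; *-distribʳ-sum; sum-replicate-zero)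
  open import Algebra.Properties.Ring ring using (-1*x≈-x)
  open import Relation.Binary.Reasoning.Setoid setoid

  Σ≡sum : ∀ {m} (f : Fin m → Carrier) → Σ[ m ] f ≡ sum f
  Σ≡sum {zero}  f = ≡.refl
  Σ≡sum {suc m} f = ≡.cong (f Fin.zero +_) (Σ≡sum (f ∘ Fin.suc))

  Σ-cong : ∀ {m} {f g : Fin m → Carrier} → (∀ k → f k ≈ g k) → Σ[ m ] f ≈ Σ[ m ] g
  Σ-cong {f = f} {g} f≈g = begin
    Σ[ _ ] f  ≡⟨ Σ≡sum f ⟩
    sum f     ≈⟨ sum-cong-≋ f≈g ⟩
    sum g     ≡⟨ Σ≡sum g ⟨
    Σ[ _ ] g  ∎

  Σ-+ : ∀ {m} (f g : Fin m → Carrier) → Σ[ m ] (λ k → f k + g k) ≈ Σ[ m ] f + Σ[ m ] g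
  Σ-+ {m} f g = begin
    Σ[ _ ] (λ k → f k + g k)  ≡⟨ Σ≡sum {m} _ ⟩
    sum (λ k → f k + g k)     ≈⟨ ∑-distrib-+ f g ⟩
    sum f + sum g             ≡⟨ ≡.cong₂ _+_ (Σ≡sum f) (Σ≡sum g) ⟨
    Σ[ _ ] f + Σ[ _ ] g       ∎

  Σ-*ˡ : ∀ {m} a (f : Fin m → Carrier) → a * Σ[ m ] f ≈ Σ[ m ] (λ k → a * f k)
  Σ-*ˡ {m} a f = begin
    a * Σ[ _ ] f            ≡⟨ ≡.cong (a *_) (Σ≡sum f) ⟩
    a * sum f               ≈⟨ *-distribˡ-sum a f ⟩
    sum (λ k → a * f k)     ≡⟨ Σ≡sum {m} _ ⟨
    Σ[ _ ] (λ k → a * f k)  ∎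

  Σ-*ʳ : ∀ {m} a (f : Fin m → Carrier) → Σ[ m ] f * a ≈ Σ[ m ] (λ k → f k * a)
  Σ-*ʳ {m} a f = begin
    Σ[ _ ] f * a            ≡⟨ ≡.cong (_* a) (Σ≡sum f) ⟩
    sum f * a               ≈⟨ *-distribʳ-sum a f ⟩
    sum (λ k → f k * a)     ≡⟨ Σ≡sum {m} _ ⟨
    Σ[ _ ] (λ k → f k * a)  ∎

  Σ-comm : ∀ {m k} (f : Fin m → Fin k → Carrier) →
    Σ[ m ] (λ a → Σ[ k ] (f a)) ≈ Σ[ k ] (λ b → Σ[ m ] (λ a → f a b))
  Σ-comm f = begin
    Σ[ _ ] (λ a → Σ[ _ ] (f a))          ≡⟨ nested f ⟩
    sum (λ a → sum (f a))                ≈⟨ ∑-comm f ⟩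
    sum (λ b → sum (λ a → f a b))        ≡⟨ nested (λ b a → f a b) ⟨
    Σ[ _ ] (λ b → Σ[ _ ] (λ a → f a b))  ∎
    where
    nested : ∀ {m k} (g : Fin m → Fin k → Carrier) → Σ[ m ] (λ a → Σ[ k ] (g a)) ≡ sum (λ a → sum (g a))
    nested {m} g = ≡.trans (Σ≡sum {m} _) (sum-cong-≗ (λ a → Σ≡sum (g a)))

  Σ-- : ∀ {m} (f g : Fin m → Carrier) → Σ[ m ] (λ k → f k - g k) ≈ Σ[ m ] f - Σ[ m ] g
  Σ-- f g = begin
    Σ[ _ ] (λ k → f k - g k)             ≈⟨ Σ-+ f (λ k → - g k) ⟩
    Σ[ _ ] f + Σ[ _ ] (λ k → - g k)      ≈⟨ +-congˡ (Σ-cong (λ k → -1*x≈-x (g k))) ⟨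
    Σ[ _ ] f + Σ[ _ ] (λ k → - 1# * g k) ≈⟨ +-congˡ (Σ-*ˡ (- 1#) g) ⟨
    Σ[ _ ] f + - 1# * Σ[ _ ] g           ≈⟨ +-congˡ (-1*x≈-x _) ⟩
    Σ[ _ ] f - Σ[ _ ] g                  ∎

  Σ-const : ∀ {m} a → Σ[ m ] (λ _ → a) ≈ fromℕ m * a
  Σ-const {zero}  a = sym (zeroˡ a)
  Σ-const {suc m} a = begin
    a + Σ[ m ] (λ _ → a)  ≈⟨ +-cong (sym (*-identityˡ a)) (Σ-const {m} a) ⟩
    1# * a + fromℕ m * a  ≈⟨ distribʳ a 1# (fromℕ m) ⟨
    fromℕ (suc m) * a     ∎

  Σ-single : ∀ {m} (s : Fin m) (f : Fin m → Carrier) → (∀ t → t ≢ s → f t ≈ 0#) → Σ[ m ] f ≈ f s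
  Σ-single {suc m} Fin.zero f others = begin
    f Fin.zero + Σ[ m ] (f ∘ Fin.suc)  ≈⟨ +-congˡ (Σ-cong (λ t → others (Fin.suc t) λ ())) ⟩
    f Fin.zero + Σ[ m ] (λ _ → 0#)     ≈⟨ +-congˡ (trans (reflexive (Σ≡sum {m} _)) (sum-replicate-zero m)) ⟩
    f Fin.zero + 0#                    ≈⟨ +-identityʳ _ ⟩
    f Fin.zero                         ∎
  Σ-single {suc m} (Fin.suc s) f others = begin
    f Fin.zero + Σ[ m ] (f ∘ Fin.suc)  ≈⟨ +-cong (others Fin.zero λ ()) (Σ-single s (f ∘ Fin.suc) (λ t t≢s → others (Fin.suc t) (t≢s ∘ suc-injective))) ⟩
    0# + f (Fin.suc s)                 ≈⟨ +-identityˡ _ ⟩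
    f (Fin.suc s)                      ∎

  Σ-indicator : ∀ {m} (g : Fin m → ℕ) → (∀ {s t} → g s ≡ g t → s ≡ t) → (f : ℕ → Carrier) → ∀ s →
    Σ[ m ] (λ t → ι ⌊ g s ℕ.≟ g t ⌋ * f (g t)) ≈ f (g s)
  Σ-indicator g injective f s = trans
    (Σ-single s _ (λ t t≢s → trans (*-congʳ (if-no (g s ℕ.≟ g t) (t≢s ∘ ≡.sym ∘ injective))) (zeroˡ _)))
    (trans (*-congʳ (if-yes (g s ℕ.≟ g s) ≡.refl)) (*-identityˡ _))

  Σ-*-Σ : ∀ {m k} (a : Fin m → Carrier) (c : Fin k → Fin m → Carrier) (b : Fin k → Carrier) →
    Σ[ m ] (λ w → a w * Σ[ k ] (λ t → c t w * b t)) ≈ Σ[ k ] (λ t → Σ[ m ] (λ w → a w * c t w) * b t)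
  Σ-*-Σ {m} {k} a c b = begin
    Σ[ m ] (λ w → a w * Σ[ k ] (λ t → c t w * b t))   ≈⟨ Σ-cong (λ w → Σ-*ˡ {k} (a w) _) ⟩
    Σ[ m ] (λ w → Σ[ k ] (λ t → a w * (c t w * b t))) ≈⟨ Σ-comm {m} {k} _ ⟩
    Σ[ k ] (λ t → Σ[ m ] (λ w → a w * (c t w * b t))) ≈⟨ Σ-cong {k} (λ t → Σ-cong {m} (λ w → *-assoc (a w) (c t w) (b t))) ⟨
    Σ[ k ] (λ t → Σ[ m ] (λ w → a w * c t w * b t))   ≈⟨ Σ-cong (λ t → Σ-*ʳ {m} (b t) _) ⟨
    Σ[ k ] (λ t → Σ[ m ] (λ w → a w * c t w) * b t)   ∎

  count-as-sum : ∀ {a p} {A : Set a} {P : Pred A p} (P? : Decidable P) {m} (g : Fin m → A) →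
    fromℕ (length (filter P? (tabulate g))) ≈ Σ[ m ] (λ k → ι ⌊ P? (g k) ⌋)
  count-as-sum P? {zero}  g = refl
  count-as-sum P? {suc m} g with P? (g Fin.zero)
  ... | yes _ = +-congˡ (count-as-sum P? (g ∘ Fin.suc))
  ... | no _  = trans (count-as-sum P? (g ∘ Fin.suc)) (sym (+-identityˡ _))

module Matrices {c ℓ : Level} (R : CommutativeRing c ℓ) where
  open CommutativeRing R
  open LinAlg R
  open Scalars R
  open FiniteSums R
  open import Algebra.Properties.Ring ring using ([y-z]x≈yx-zx)
  open import Algebra.Properties.Group +-group using (x∙y⁻¹≈ε⇒x≈y; x≈y⇒x∙y⁻¹≈ε)
  open import Algebra.Solver.Ring.NaturalCoefficients.Default commutativeSemiring
    using (solve; _:*_; _:=_)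
  open import Relation.Binary.Reasoning.Setoid setoid

  -- ⟨ P , Q ⟩ unfolds to the double sum of entrywise products  Σ² (λ w y → P w y * Q w y).
  Σ² : ∀ {n} → (Fin n → Fin n → Carrier) → Carrier
  Σ² {n} f = Σ[ n ] (λ y → Σ[ n ] (λ w → f w y))

  Σ²-cong : ∀ {n} {f g : Fin n → Fin n → Carrier} → (∀ w y → f w y ≈ g w y) → Σ² f ≈ Σ² g
  Σ²-cong f≈g = Σ-cong (λ y → Σ-cong (λ w → f≈g w y))

  Σ²-+ : ∀ {n} (f g : Fin n → Fin n → Carrier) → Σ² (λ w y → f w y + g w y) ≈ Σ² f + Σ² g
  Σ²-+ {n} f g = trans (Σ-cong (λ y → Σ-+ {n} (λ w → f w y) (λ w → g w y))) (Σ-+ {n} _ _)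

  Σ²-- : ∀ {n} (f g : Fin n → Fin n → Carrier) → Σ² (λ w y → f w y - g w y) ≈ Σ² f - Σ² g
  Σ²-- {n} f g = trans (Σ-cong (λ y → Σ-- {n} (λ w → f w y) (λ w → g w y))) (Σ-- {n} _ _)

  ⟨⟩-cong : ∀ {n} {P P′ Q Q′ : Mat n} → P ≈M P′ → Q ≈M Q′ → ⟨ P , Q ⟩ ≈ ⟨ P′ , Q′ ⟩
  ⟨⟩-cong P≈ Q≈ = Σ²-cong (λ w y → *-cong (P≈ w y) (Q≈ w y))

  ‖ᵗ‖² : ∀ {n} (P : Mat n) → ‖ P ᵗ ‖² ≈ ‖ P ‖²
  ‖ᵗ‖² {n} P = Σ-comm {n} {n} (λ y w → P y w * P y w)

  ⟨⊕,⊖⟩ : ∀ {n} (U V : Mat n) → ⟨ U ⊕ V , U ⊖ V ⟩ ≈ ‖ U ‖² - ‖ V ‖²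
  ⟨⊕,⊖⟩ {n} U V = trans (Σ²-cong (λ w y → difference-of-squares (U w y) (V w y))) (Σ²-- {n} _ _)

  ‖⊕‖² : ∀ {n} (U V : Mat n) → ‖ U ⊕ V ‖² ≈ (‖ U ‖² + ‖ V ‖²) + (⟨ U , V ⟩ + ⟨ U , V ⟩)
  ‖⊕‖² {n} U V = begin
    ‖ U ⊕ V ‖²  ≈⟨ Σ²-cong (λ w y → square-of-sum (U w y) (V w y)) ⟩
    Σ² (λ w y → (U w y * U w y + V w y * V w y) + (U w y * V w y + U w y * V w y))
                ≈⟨ trans (Σ²-+ {n} _ _) (+-cong (Σ²-+ {n} _ _) (Σ²-+ {n} _ _)) ⟩
    (‖ U ‖² + ‖ V ‖²) + (⟨ U , V ⟩ + ⟨ U , V ⟩) ∎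

  ‖⊖‖² : ∀ {n} (U V : Mat n) → ‖ U ⊖ V ‖² ≈ (‖ U ‖² + ‖ V ‖²) - (⟨ U , V ⟩ + ⟨ U , V ⟩)
  ‖⊖‖² {n} U V = begin
    ‖ U ⊖ V ‖²  ≈⟨ Σ²-cong (λ w y → square-of-difference (U w y) (V w y)) ⟩
    Σ² (λ w y → (U w y * U w y + V w y * V w y) - (U w y * V w y + U w y * V w y))
                ≈⟨ trans (Σ²-- {n} _ _) (+-cong (Σ²-+ {n} _ _) (-‿cong (Σ²-+ {n} _ _))) ⟩
    (‖ U ‖² + ‖ V ‖²) - (⟨ U , V ⟩ + ⟨ U , V ⟩) ∎

  ·-diag : ∀ {n} (M : Mat n) (d : Fin n → Carrier) → (M · diag d) ≈M (λ y z → M y z * d z)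
  ·-diag M d y z = trans
    (Σ-single z _ (λ w w≢z → trans (*-congˡ (if-no (w Fin.≟ z) w≢z)) (zeroʳ _)))
    (*-congˡ (if-yes (z Fin.≟ z) ≡.refl))

  diag-· : ∀ {n} (d : Fin n → Carrier) (M : Mat n) → (diag d · M) ≈M (λ y z → d y * M y z)
  diag-· d M y z = trans
    (Σ-single y _ (λ w w≢y → trans (*-congʳ (if-no (y Fin.≟ w) (w≢y ∘ ≡.sym))) (zeroˡ _)))
    (*-congʳ (if-yes (y Fin.≟ y) ≡.refl))

  combination : ∀ {n k} → (Fin k → Carrier) → (Fin k → Mat n) → Mat n
  combination {k = k} α B y z = Σ[ k ] (λ h → α h * B h y z)

  ·-combination : ∀ {n k} (A : Mat n) α (B : Fin k → Mat n) →
    (A · combination α B) ≈M combination α (λ h → A · B h)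
  ·-combination {n} {k} A α B w z = begin
    Σ[ _ ] (λ y → A w y * Σ[ _ ] (λ h → α h * B h y z))   ≈⟨ Σ-cong (λ y → Σ-*ˡ {k} (A w y) _) ⟩
    Σ[ _ ] (λ y → Σ[ _ ] (λ h → A w y * (α h * B h y z))) ≈⟨ Σ-comm {n} {k} _ ⟩
    Σ[ _ ] (λ h → Σ[ _ ] (λ y → A w y * (α h * B h y z))) ≈⟨ Σ-cong (λ h → Σ-cong (λ y → solve 3 (λ a b e → a :* (b :* e) := b :* (a :* e)) refl (A w y) (α h) (B h y z))) ⟩
    Σ[ _ ] (λ h → Σ[ _ ] (λ y → α h * (A w y * B h y z))) ≈⟨ Σ-cong (λ h → Σ-*ˡ {n} (α h) _) ⟨
    combination α (λ h → A · B h) w z                     ∎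

  combination-· : ∀ {n k} α (B : Fin k → Mat n) (A : Mat n) →
    (combination α B · A) ≈M combination α (λ h → B h · A)
  combination-· {n} {k} α B A w z = begin
    Σ[ _ ] (λ y → Σ[ _ ] (λ h → α h * B h w y) * A y z)   ≈⟨ Σ-cong (λ y → Σ-*ʳ {k} (A y z) _) ⟩
    Σ[ _ ] (λ y → Σ[ _ ] (λ h → α h * B h w y * A y z))   ≈⟨ Σ-comm {n} {k} _ ⟩
    Σ[ _ ] (λ h → Σ[ _ ] (λ y → α h * B h w y * A y z))   ≈⟨ Σ-cong (λ h → Σ-cong {n} (λ y → *-assoc (α h) _ _)) ⟩
    Σ[ _ ] (λ h → Σ[ _ ] (λ y → α h * (B h w y * A y z))) ≈⟨ Σ-cong (λ h → Σ-*ˡ {n} (α h) _) ⟨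
    combination α (λ h → B h · A) w z                     ∎

  commutes-with-combination : ∀ {n k} (A M : Mat n) α (B : Fin k → Mat n) → M ≈M combination α B →
    (∀ h → (A · B h) ≈M (B h · A)) → (A · M) ≈M (M · A)
  commutes-with-combination {n} A M α B M≈ comm w z = begin
    (A · M) w z                            ≈⟨ Σ-cong (λ y → *-congˡ (M≈ y z)) ⟩
    (A · combination α B) w z              ≈⟨ ·-combination A α B w z ⟩
    combination α (λ h → A · B h) w z      ≈⟨ Σ-cong (λ h → *-congˡ (comm h w z)) ⟩
    combination α (λ h → B h · A) w z      ≈⟨ combination-· α B A w z ⟨
    (combination α B · A) w z              ≈⟨ Σ-cong {n} (λ y → *-congʳ (M≈ w y)) ⟨
    (M · A) w z                            ∎

  coordinates-unique : ∀ {n r} {v : Fin r → Fin n → Carrier} → LinIndep v →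
    (α β : Fin r → Carrier) → (∀ y → Σ[ r ] (λ t → α t * v t y) ≈ Σ[ r ] (λ t → β t * v t y)) →
    ∀ t → α t ≈ β t
  coordinates-unique {r = r} {v = v} independent α β same t =
    x∙y⁻¹≈ε⇒x≈y (α t) (β t) (independent (λ t → α t - β t) difference-vanishes t)
    where
    difference-vanishes : ∀ y → Σ[ _ ] (λ t → (α t - β t) * v t y) ≈ 0#
    difference-vanishes y = begin
      Σ[ _ ] (λ t → (α t - β t) * v t y)                            ≈⟨ Σ-cong (λ t → [y-z]x≈yx-zx (v t y) (α t) (β t)) ⟩
      Σ[ _ ] (λ t → α t * v t y - β t * v t y)                       ≈⟨ Σ-- {r} _ _ ⟩
      Σ[ _ ] (λ t → α t * v t y) - Σ[ _ ] (λ t → β t * v t y)       ≈⟨ x≈y⇒x∙y⁻¹≈ε (same y) ⟩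
      0#                                                             ∎

  -- The trace of an idempotent matrix is its rank: writing every column in
  -- the basis of selected columns v_t, idempotence gives  v_s = Σ_t G_ts v_t
  -- with  G_ts = Σ_w B_wt M_w,sel(s), so G is the identity and tr M = Σ_t G_tt = r.
  trace-idempotent : ∀ {n} (M : Mat n) → (M · M) ≈M M → ∀ r → HasRank M r → tr M ≈ fromℕ r
  trace-idempotent {n} M idempotent r (sel , independent , spans) = begin
    Σ[ n ] (λ y → M y y)                            ≈⟨ Σ-cong (λ y → coordinates y y) ⟩
    Σ[ n ] (λ y → Σ[ r ] (λ t → B y t * v t y))     ≈⟨ Σ-comm {n} {r} _ ⟩
    Σ[ r ] (λ t → G t t)                            ≈⟨ Σ-cong G-diagonal ⟩
    Σ[ r ] (λ _ → 1#)                               ≈⟨ Σ-const {r} 1# ⟩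
    fromℕ r * 1#                                    ≈⟨ *-identityʳ _ ⟩
    fromℕ r                                         ∎
    where
    v : Fin r → Fin n → Carrier
    v t y = M y (sel t)
    B : Fin n → Fin r → Carrier
    B z = proj₁ (spans z)
    coordinates : ∀ z y → M y z ≈ Σ[ r ] (λ t → B z t * v t y)
    coordinates z = proj₂ (spans z)
    G : Fin r → Fin r → Carrier
    G t s = Σ[ n ] (λ w → B w t * M w (sel s))
    δ : Fin r → Fin r → Carrier
    δ t s = ι ⌊ t Fin.≟ s ⌋

    column-via-G : ∀ s y → Σ[ r ] (λ t → G t s * v t y) ≈ v s y
    column-via-G s y = begin
      Σ[ r ] (λ t → G t s * v t y)                              ≈⟨ Σ-cong (λ t → Σ-*ʳ {n} (v t y) _) ⟩
      Σ[ r ] (λ t → Σ[ n ] (λ w → B w t * M w (sel s) * v t y)) ≈⟨ Σ-comm {r} {n} _ ⟩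
      Σ[ n ] (λ w → Σ[ r ] (λ t → B w t * M w (sel s) * v t y)) ≈⟨ Σ-cong (λ w → Σ-cong (λ t → solve 3 (λ b e c → b :* e :* c := e :* (b :* c)) refl (B w t) (M w (sel s)) (v t y))) ⟩
      Σ[ n ] (λ w → Σ[ r ] (λ t → M w (sel s) * (B w t * v t y))) ≈⟨ Σ-cong (λ w → Σ-*ˡ {r} (M w (sel s)) _) ⟨
      Σ[ n ] (λ w → M w (sel s) * Σ[ r ] (λ t → B w t * v t y)) ≈⟨ Σ-cong (λ w → trans (*-congʳ (coordinates w y)) (*-comm _ _)) ⟨
      (M · M) y (sel s)                                         ≈⟨ idempotent y (sel s) ⟩
      v s y                                                     ∎

    column-via-δ : ∀ s y → Σ[ r ] (λ t → δ t s * v t y) ≈ v s y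
    column-via-δ s y = trans
      (Σ-single s _ (λ t t≢s → trans (*-congʳ (if-no (t Fin.≟ s) t≢s)) (zeroˡ _)))
      (trans (*-congʳ (if-yes (s Fin.≟ s) ≡.refl)) (*-identityˡ _))

    G-diagonal : ∀ t → G t t ≈ 1#
    G-diagonal t = trans
      (coordinates-unique independent (λ t′ → G t′ t) (λ t′ → δ t′ t)
        (λ y → trans (column-via-G t y) (sym (column-via-δ t y))) t)
      (if-yes (t Fin.≟ t) ≡.refl)

-- Graph distance.

module Distance {n : ℕ} (adj : Fin n → Fin n → Bool)
                (symmetric : ∀ y z → adj y z ≡ adj z y)
                (loopless : ∀ y → adj y y ≡ false)
                (connected : ∀ y z → ∃[ k ] reach adj k y z ≡ true) where

  open import Data.Nat using (_+_; _<_)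
  open import Data.Bool using (T)
  open import Data.Bool.Properties using (T-≡; T-∨; T-∧)
  open import Data.Fin.Subset using (Subset; _∈_; ∣_∣)
  open import Data.Fin.Subset.Properties using (p⊂q⇒∣p∣<∣q∣; ∣p∣≤n; x∈p⇒∣p-x∣<∣p∣)
  open import Data.Fin.Properties using (any?; toℕ<n; toℕ-fromℕ<)
  open import Data.List.Membership.Propositional using (lose)
  open import Data.List.Membership.Propositional.Properties using (∈-allFin)
  open import Data.List.Relation.Unary.Any using (satisfied)
  open import Data.List.Relation.Unary.Any.Properties using (any⁺; any⁻)
  open import Data.Nat.Properties
  open import Data.Sum using (_⊎_; inj₁; inj₂)
  import Data.Sum as Sum
  open import Data.Unit using (tt)
  import Data.Vec as Vec
  open import Data.Vec.Properties using (lookup∘tabulate; []=⇒lookup; lookup⇒[]=)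
  open import Function.Bundles using (Equivalence)
  open import Relation.Nullary using (¬?; _×-dec_)
  open import Relation.Nullary.Decidable using (T?; toWitness; fromWitness; decidable-stable)
  open Equivalence using (to; from)

  -- The boolean relations of Defs, wrapped in records so that y, z and k
  -- can be inferred from a proof.
  record Adj (y z : Fin n) : Set where
    constructor edge
    field edge⁻¹ : T (adj y z)

  record Reach (k : ℕ) (y z : Fin n) : Set where
    constructor walk
    field walk⁻¹ : T (reach adj k y z)

  ∂ : Fin n → Fin n → ℕ
  ∂ = dist adj

  adj-sym : ∀ {y z} → Adj y z → Adj z y
  adj-sym {y} {z} (edge a) = edge (≡.subst T (symmetric y z) a)

  reach-refl : ∀ y → Reach 0 y y
  reach-refl y = walk (fromWitness ≡.refl)

  reach-zero : ∀ {y z} → Reach 0 y z → y ≡ z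
  reach-zero (walk r) = toWitness r

  reach-suc : ∀ {k y z} → Reach k y z → Reach (suc k) y z
  reach-suc (walk r) = walk (from T-∨ (inj₁ r))

  reach-step : ∀ {k y w z} → Adj y w → Reach k w z → Reach (suc k) y z
  reach-step {w = w} (edge a) (walk r) =
    walk (from T-∨ (inj₂ (any⁺ _ (lose (∈-allFin w) (from T-∧ (a , r))))))

  reach-step⁻ : ∀ {k y z} → Reach (suc k) y z → Reach k y z ⊎ ∃[ w ] Adj y w × Reach k w z
  reach-step⁻ (walk r) with to T-∨ r
  ... | inj₁ r′    = inj₁ (walk r′)
  ... | inj₂ found with satisfied (any⁻ _ (allV n) found)
  ...   | w , aw with to T-∧ aw
  ...     | a , r′ = inj₂ (w , edge a , walk r′)

  reach-snoc : ∀ k {y w z} → Reach k y w → Adj w z → Reach (suc k) y z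
  reach-snoc zero    {z = z} r a with reach-zero r
  ... | ≡.refl = reach-step a (reach-refl z)
  reach-snoc (suc k) r a with reach-step⁻ r
  ... | inj₁ r′            = reach-suc (reach-snoc k r′ a)
  ... | inj₂ (v , av , r′) = reach-step av (reach-snoc k r′ a)

  reach-sym : ∀ k {y z} → Reach k y z → Reach k z y
  reach-sym zero    r with reach-zero r
  ... | ≡.refl = r
  reach-sym (suc k) r with reach-step⁻ r
  ... | inj₁ r′           = reach-suc (reach-sym k r′)
  ... | inj₂ (w , a , r′) = reach-snoc k (reach-sym k r′) (adj-sym a)

  reach-weaken : ∀ l {k y z} → Reach k y z → Reach (l + k) y z
  reach-weaken zero    r = r
  reach-weaken (suc l) r = reach-suc (reach-weaken l r)

  first-below : ∀ k fuel j {y z} → k ≤ j → j < firstReach adj k fuel y z → ¬ Reach j y z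
  first-below k zero       j k≤j j<k = ⊥-elim (<-irrefl ≡.refl (<-≤-trans j<k k≤j))
  first-below k (suc fuel) j {y} {z} k≤j j< with reach adj k y z in found
  ... | true  = ⊥-elim (<-irrefl ≡.refl (<-≤-trans j< k≤j))
  ... | false with m≤n⇒m<n∨m≡n k≤j
  ...   | inj₁ k<j    = first-below (suc k) fuel j k<j j<
  ...   | inj₂ ≡.refl = λ (walk r) → ≡.subst T found r

  first-hit : ∀ k fuel {y z} → firstReach adj k fuel y z < k + fuel →
              Reach (firstReach adj k fuel y z) y z
  first-hit k zero       lt = ⊥-elim (<-irrefl (≡.sym (+-identityʳ k)) lt)
  first-hit k (suc fuel) {y} {z} lt with reach adj k y z in found
  ... | true  = walk (≡.subst T (≡.sym found) tt)
  ... | false = first-hit (suc k) fuel (≡.subst (firstReach adj (suc k) fuel y z <_) (+-suc k fuel) lt)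

  dist-le : ∀ {j y z} → Reach j y z → ∂ y z ≤ j
  dist-le {j} r = ≮⇒≥ (λ j<∂ → first-below 0 n j z≤n j<∂ r)

  -- For a fixed target z the layers  {y | Reach k y z}  grow with k, and
  -- once a layer does not grow it never grows again.  As layers have at
  -- most n elements, this happens after fewer than n steps.
  module Layers (z : Fin n) where
    layer : ℕ → Subset n
    layer k = Vec.tabulate (λ y → reach adj k y z)

    ∈-layer⁺ : ∀ {k y} → Reach k y z → y ∈ layer k
    ∈-layer⁺ {k} {y} (walk r) = lookup⇒[]= y _ (≡.trans (lookup∘tabulate _ y) (to T-≡ r))

    ∈-layer⁻ : ∀ {k y} → y ∈ layer k → Reach k y z
    ∈-layer⁻ {k} {y} y∈ = walk (from T-≡ (≡.trans (≡.sym (lookup∘tabulate _ y)) ([]=⇒lookup y∈)))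

    Stable : ℕ → Set
    Stable j = ∀ y → Reach (suc j) y z → Reach j y z

    -- since layer (k+1) is determined by layer k, stability persists
    stable-forever : ∀ {j} → Stable j → ∀ l y → Reach (l + j) y z → Reach j y z
    stable-forever st zero    y r = r
    stable-forever st (suc l) y r with reach-step⁻ r
    ... | inj₁ r′           = stable-forever st l y r′
    ... | inj₂ (w , a , r′) = st y (reach-step a (stable-forever st l w r′))

    grows-or-stable : ∀ k → Stable k ⊎ ∣ layer k ∣ < ∣ layer (suc k) ∣
    grows-or-stable k with any? (λ y → T? (reach adj (suc k) y z) ×-dec ¬? (T? (reach adj k y z)))
    ... | yes (y , new , ¬old) = inj₂ (p⊂q⇒∣p∣<∣q∣
            ( (λ y∈ → ∈-layer⁺ (reach-suc (∈-layer⁻ {k} y∈)))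
            , y , ∈-layer⁺ {suc k} (walk new) , λ y∈ → ¬old (Reach.walk⁻¹ (∈-layer⁻ {k} y∈))))
    ... | no none = inj₁ (λ y (walk r) → walk (decidable-stable (T? _) (λ ¬old → none (y , r , ¬old))))

    stable-or-large : ∀ k → (∃[ j ] j ≤ k × Stable j) ⊎ suc (suc k) ≤ ∣ layer (suc k) ∣
    stable-or-large zero = Sum.map (λ st → 0 , z≤n , st) (≤-trans (s≤s nonempty)) (grows-or-stable 0)
      where
      nonempty : 1 ≤ ∣ layer 0 ∣
      nonempty = ≤-trans (s≤s z≤n) (x∈p⇒∣p-x∣<∣p∣ (∈-layer⁺ (reach-refl z)))
    stable-or-large (suc k) with stable-or-large k
    ... | inj₁ (j , j≤k , st) = inj₁ (j , m≤n⇒m≤1+n j≤k , st)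
    ... | inj₂ large = Sum.map (λ st → suc k , ≤-refl , st) (≤-trans (s≤s large)) (grows-or-stable (suc k))

    -- n ≠ 0 since z : Fin n
    n≡1+pred : suc (ℕ.pred n) ≡ n
    n≡1+pred = suc-pred n {{ℕ.>-nonZero (≤-trans (s≤s z≤n) (toℕ<n z))}}

    stable-below-n : ∃[ j ] j < n × Stable j
    stable-below-n with stable-or-large (ℕ.pred n)
    ... | inj₁ (j , j≤pred , st) = j , ≡.subst (j <_) n≡1+pred (s≤s j≤pred) , st
    ... | inj₂ large = ⊥-elim (<-irrefl ≡.refl
            (≤-trans large (≡.subst (∣ layer (suc (ℕ.pred n)) ∣ ≤_) (≡.sym n≡1+pred) (∣p∣≤n (layer (suc (ℕ.pred n)))))))

  -- every target reached at all is reached within a stable number j < n of steps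
  dist<n : ∀ y z → ∂ y z < n
  dist<n y z with Layers.stable-below-n z | connected y z
  ... | j , j<n , st | k , reached = ≤-<-trans (dist-le within-j) j<n
    where
    within-j : Reach j y z
    within-j = Layers.stable-forever z st k y
      (≡.subst (λ l → Reach l y z) (+-comm j k) (reach-weaken j (walk (from T-≡ reached))))

  dist-reach : ∀ y z → Reach (∂ y z) y z
  dist-reach y z = first-hit 0 n (dist<n y z)

  dist-refl : ∀ y → ∂ y y ≡ 0
  dist-refl y = n≤0⇒n≡0 (dist-le (reach-refl y))

  dist-zero : ∀ {y z} → ∂ y z ≡ 0 → y ≡ z
  dist-zero {y} {z} e = reach-zero (≡.subst (λ k → Reach k y z) e (dist-reach y z))

  dist-sym : ∀ y z → ∂ y z ≡ ∂ z y
  dist-sym y z = ≤-antisym (dist-le (reach-sym _ (dist-reach z y))) (dist-le (reach-sym _ (dist-reach y z)))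

  dist-edge : ∀ {y w} z → Adj y w → ∂ y z ≤ suc (∂ w z)
  dist-edge z a = dist-le (reach-step a (dist-reach _ z))

  adj⇒dist1 : ∀ {y w} → Adj y w → ∂ y w ≡ 1
  adj⇒dist1 {y} {w} a = ≤-antisym (dist-le (reach-step a (reach-refl w))) (n≢0⇒n>0 not-zero)
    where
    not-zero : ∂ y w ≢ 0
    not-zero e with dist-zero e
    ... | ≡.refl = ≡.subst T (loopless y) (Adj.edge⁻¹ a)

  dist1⇒adj : ∀ {y w} → ∂ y w ≡ 1 → Adj y w
  dist1⇒adj {y} {w} e with reach-step⁻ (≡.subst (λ k → Reach k y w) e (dist-reach y w))
  ... | inj₁ r₀ = ⊥-elim (<-irrefl ≡.refl (≤-trans (≤-reflexive (≡.sym e)) (dist-le r₀)))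
  ... | inj₂ (v , a , r₀) with reach-zero r₀
  ...   | ≡.refl = a

  step-down : ∀ {y z i} → ∂ y z ≡ suc i → ∃[ w ] Adj y w × ∂ w z ≡ i
  step-down {y} {z} {i} e with reach-step⁻ (≡.subst (λ k → Reach k y z) e (dist-reach y z))
  ... | inj₁ r = ⊥-elim (<-irrefl ≡.refl (≤-trans (≤-reflexive (≡.sym e)) (dist-le r)))
  ... | inj₂ (w , a , r) = w , a , ≤-antisym (dist-le r)
                                   (ℕ.s≤s⁻¹ (≤-trans (≤-reflexive (≡.sym e)) (dist-edge z a)))

  -- The neighbours of a vertex at distance k+1 from x lie at distance
  -- k, k+1 or k+2 from x, i.e. at distance  t + k  with  t : Fin 3.
  neighbour-distance : ∀ {x y w k} → ∂ y x ≡ suc k → Adj y w → ∃[ t ] ∂ x w ≡ toℕ {3} t + k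
  neighbour-distance {x} {y} {w} {k} e a =
    Fin.fromℕ< (s≤s (m≤n+o⇒m∸n≤o (∂ x w) k upper)) ,
    ≡.trans (≡.sym (m∸n+n≡m lower)) (≡.cong (_+ k) (≡.sym (toℕ-fromℕ< _)))
    where
    lower : k ≤ ∂ x w
    lower = ≡.subst (k ≤_) (dist-sym w x) (ℕ.s≤s⁻¹ (≤-trans (≤-reflexive (≡.sym e)) (dist-edge x a)))
    upper : ∂ x w ≤ k + 2
    upper = ≡.subst₂ _≤_ (dist-sym w x) (+-comm 2 k) (≤-trans (dist-edge x (adj-sym a)) (s≤s (≤-reflexive e)))

module NonemptyLists where
  open import Data.List.Membership.Propositional using (_∈_)
  open import Data.List.Relation.Unary.Any using (here; there)

  member⇒nonempty : ∀ {a} {A : Set a} {x : A} {xs} → x ∈ xs → 1 ≤ length xs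
  member⇒nonempty (here _)  = s≤s z≤n
  member⇒nonempty (there _) = s≤s z≤n

  nonempty⇒member : ∀ {a} {A : Set a} {xs : List A} → 1 ≤ length xs → ∃[ x ] x ∈ xs
  nonempty⇒member {xs = x ∷ _} _ = x , here ≡.refl

-- Distance-regular graphs: the distance matrices A_i, their products
-- (A_i A_j)_yz = p^{∂(y,z)}_ij, row sums k_i, and positivity of the
-- intersection numbers needed for the recurrence of the u_i.

module DistanceRegular {c ℓ : Level} (R : CommutativeRing c ℓ)
       {n : ℕ} (adj : Fin n → Fin n → Bool) {D : ℕ} {p : ℕ → ℕ → ℕ → ℕ}
       (drg : IsDRG n adj D p) where
  open CommutativeRing R
  open LinAlg R
  open Scalars R
  open FiniteSums R
  open IsDRG drg
  open Distance adj symmetric loopless connected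
  open NonemptyLists
  open import Data.Nat.Properties using (_≟_; m≤n⇒m<n∨m≡n)
  open import Data.List.Membership.Propositional.Properties using (∈-allFin; ∈-filter⁺; ∈-filter⁻)
  open import Data.Sum using (inj₁; inj₂)
  open import Relation.Binary.Reasoning.Setoid setoid

  A : ℕ → Mat n
  A = distMat adj

  A-sym : ∀ i y z → A i y z ≈ A i z y
  A-sym i y z = reflexive (≡.cong (λ e → ι ⌊ e ≟ i ⌋) (dist-sym y z))

  A-idem : ∀ i y z → A i y z * A i y z ≈ A i y z
  A-idem i y z = ι-idem _

  A-support : ∀ i y w {f g} → (∂ y w ≡ i → f ≈ g) → A i y w * f ≈ A i y w * g
  A-support i y w = ι-support (∂ y w ≟ i)

  Between? : ∀ y z i j w → Dec (∂ y w ≡ i × ∂ z w ≡ j)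
  Between? y z i j w = (∂ y w ≟ i) ×-dec (∂ z w ≟ j)

  pcount-as-sum : ∀ y z i j → fromℕ (pcount adj y z i j) ≈ Σ[ n ] (λ w → A i y w * A j z w)
  pcount-as-sum y z i j =
    trans (count-as-sum (Between? y z i j) id) (Σ-cong (λ w → ι-× (∂ y w ≟ i) (∂ z w ≟ j)))

  A·A : ∀ i j y z → (A i · A j) y z ≈ fromℕ (p (∂ y z) i j)
  A·A i j y z = begin
    Σ[ n ] (λ w → A i y w * A j w z)  ≈⟨ Σ-cong (λ w → *-congˡ (A-sym j w z)) ⟩
    Σ[ n ] (λ w → A i y w * A j z w)  ≈⟨ pcount-as-sum y z i j ⟨
    fromℕ (pcount adj y z i j)        ≡⟨ ≡.cong fromℕ (regular y z i j) ⟩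
    fromℕ (p (∂ y z) i j)             ∎

  A-commute : ∀ i j → (A i · A j) ≈M (A j · A i)
  A-commute i j y z = begin
    (A i · A j) y z        ≈⟨ A·A i j y z ⟩
    fromℕ (p (∂ y z) i j)  ≡⟨ ≡.cong (λ e → fromℕ (p e i j)) (dist-sym y z) ⟩
    fromℕ (p (∂ z y) i j)  ≈⟨ A·A i j z y ⟨
    (A i · A j) z y        ≈⟨ Σ-cong (λ w → trans (*-comm _ _) (*-cong (A-sym j w y) (A-sym i z w))) ⟩
    (A j · A i) y z        ∎

  row-sum : ∀ i y → Σ[ n ] (λ w → A i y w) ≈ fromℕ (kk p i)
  row-sum i y = begin
    Σ[ n ] (λ w → A i y w)            ≈⟨ Σ-cong (λ w → A-idem i y w) ⟨
    Σ[ n ] (λ w → A i y w * A i y w)  ≈⟨ pcount-as-sum y y i i ⟨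
    fromℕ (pcount adj y y i i)        ≡⟨ ≡.cong fromℕ (≡.trans (regular y y i i) (≡.cong (λ e → p e i i) (dist-refl y))) ⟩
    fromℕ (kk p i)                    ∎

  column-sum : ∀ i y → Σ[ n ] (λ w → A i w y) ≈ fromℕ (kk p i)
  column-sum i y = trans (Σ-cong (λ w → A-sym i w y)) (row-sum i y)

  p-positive : ∀ {y z w h i j} → ∂ y z ≡ h → ∂ y w ≡ i → ∂ z w ≡ j → 1 ≤ p h i j
  p-positive {y} {z} {w} {h} {i} {j} e e₁ e₂ =
    ≡.subst (1 ≤_) (≡.trans (regular y z i j) (≡.cong (λ e → p e i j) e))
      (member⇒nonempty (∈-filter⁺ (Between? y z i j) (∈-allFin w) (e₁ , e₂)))

  p-witness : ∀ {y z i j} → 1 ≤ p (∂ y z) i j → ∃[ w ] ∂ y w ≡ i × ∂ z w ≡ j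
  p-witness {y} {z} {i} {j} pos with nonempty⇒member (≡.subst (1 ≤_) (≡.sym (regular y z i j)) pos)
  ... | w , w∈ = w , proj₂ (∈-filter⁻ (Between? y z i j) {xs = allV n} w∈)

  -- every distance h ≤ D occurs, by walking down a diameter
  distance-attained : ∀ {h} → h ≤ D → ∃[ y ] ∃[ z ] ∂ y z ≡ h
  distance-attained h≤D with diam-attain
  ... | y , z , e = descend D e h≤D
    where
    descend : ∀ k {y z h} → ∂ y z ≡ k → h ≤ k → ∃[ y′ ] ∃[ z′ ] ∂ y′ z′ ≡ h
    descend zero    e z≤n = _ , _ , e
    descend (suc k) e h≤ with m≤n⇒m<n∨m≡n h≤
    ... | inj₂ ≡.refl = _ , _ , e
    ... | inj₁ h<     with step-down e
    ...   | _ , _ , e′ = descend k e′ (ℕ.s≤s⁻¹ h<)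

  k-positive : ∀ {h} → h ≤ D → 1 ≤ kk p h
  k-positive h≤D with distance-attained h≤D
  ... | y , z , e = p-positive (dist-refl z) (≡.trans (dist-sym z y) e) (≡.trans (dist-sym z y) e)

  b-positive : ∀ {i} → suc (suc i) ≤ D → 1 ≤ bb p (suc i)
  b-positive le with distance-attained le
  ... | w , z , e with step-down e
  ...   | v , a , e′ = p-positive e′ (adj⇒dist1 (adj-sym a))
                                     (≡.trans (dist-sym z w) e)

  sphere-nonempty : ∀ x {h} → h ≤ D → ∃[ y ] ∂ y x ≡ h
  sphere-nonempty x {h} h≤D
    with p-witness {x} {x} (≡.subst (λ e → 1 ≤ p e h h) (≡.sym (dist-refl x)) (k-positive h≤D))
  ... | y , e , _ = y , ≡.trans (dist-sym y x) e

-- A primitive idempotent E_j of the Bose–Mesner algebra, seen from a base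
-- vertex x.  Since E_j = Σ_h α_h A_h, its entry at (y,z) depends only on
-- ∂(y,z): E_j y z = profile (∂ y z).  The eigenvalue equation A E_j = θ_j E_j
-- read at (y,x) gives the three-term recurrence of the u_i, whence
-- profile i = profile 0 · u_i(θ_j); the rank gives |X| · profile 0 = m_j.

module PrimitiveIdempotent {c ℓ : Level} (R : CommutativeRing c ℓ) (F : LinAlg.FieldChar0 R)
       {n : ℕ} (adj : Fin n → Fin n → Bool) {D : ℕ} {p : ℕ → ℕ → ℕ → ℕ}
       (drg : IsDRG n adj D p)
       (E : Fin (suc D) → LinAlg.Mat R n) (θ : Fin (suc D) → CommutativeRing.Carrier R)
       (idempotents : LinAlg.PrimIdem R F n adj D E θ)
       (x : Fin n) (j : Fin (suc D)) where
  open CommutativeRing R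
  open LinAlg R
  open Scalars R
  open FiniteSums R
  open Matrices R
  open IsDRG drg
  open Distance adj symmetric loopless connected
  open DistanceRegular R adj drg
  open PrimIdem idempotents
  open FieldChar0 F using (inv)
  open import Data.Nat.Properties using (_≟_; n≤1+n; ≤-trans; +-cancelʳ-≡)
  open import Data.Fin.Properties using (toℕ-injective)
  open import Relation.Binary.Reasoning.Setoid setoid
  open import Algebra.Solver.Ring.NaturalCoefficients.Default commutativeSemiring
    using (solve; _:*_; _:=_)

  u : ℕ → Carrier
  u i = uPoly F p i (θ j)

  α : Fin (suc D) → Carrier
  α = proj₁ (inM j)

  profile : ℕ → Carrier
  profile k = Σ[ suc D ] (λ h → α h * ι ⌊ k ≟ toℕ h ⌋)

  E-profile : ∀ y z → E j y z ≈ profile (∂ y z)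
  E-profile = proj₂ (inM j)

  E-diagonal : ∀ y → E j y y ≈ profile 0
  E-diagonal y = trans (E-profile y y) (reflexive (≡.cong profile (dist-refl y)))

  E-commute : ∀ i → (A i · E j) ≈M (E j · A i)
  E-commute i = commutes-with-combination (A i) (E j) α (λ h → A (toℕ h)) (proj₂ (inM j))
                                          (λ h → A-commute i (toℕ h))

  rank-profile : ∀ {m} → HasRank (E j) m → fromℕ n * profile 0 ≈ fromℕ m
  rank-profile {m} rank = begin
    fromℕ n * profile 0          ≈⟨ Σ-const {n} (profile 0) ⟨
    Σ[ n ] (λ _ → profile 0)     ≈⟨ Σ-cong E-diagonal ⟨
    tr (E j)                     ≈⟨ trace-idempotent (E j) (idem j) m rank ⟩
    fromℕ m                      ∎

  row-square : Σ[ n ] (λ w → E j x w * E j x w) ≈ E j x x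
  row-square = trans (Σ-cong (λ w → *-congˡ (symm j x w))) (idem j x x)

  eigen-row : ∀ y → Σ[ n ] (λ w → A 1 y w * profile (∂ w x)) ≈ θ j * profile (∂ y x)
  eigen-row y = begin
    Σ[ n ] (λ w → A 1 y w * profile (∂ w x)) ≈⟨ Σ-cong (λ w → *-congˡ (E-profile w x)) ⟨
    (A 1 · E j) y x                          ≈⟨ eigen j y x ⟩
    θ j * E j y x                            ≈⟨ *-congˡ (E-profile y x) ⟩
    θ j * profile (∂ y x)                    ∎

  -- at y = x all neighbours are at distance 1:  k₁ profile 1 = θ profile 0
  first-relation : fromℕ (kk p 1) * profile 1 ≈ θ j * profile 0
  first-relation = begin
    fromℕ (kk p 1) * profile 1                ≈⟨ *-congʳ (row-sum 1 x) ⟨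
    Σ[ n ] (λ w → A 1 x w) * profile 1        ≈⟨ Σ-*ʳ {n} (profile 1) _ ⟩
    Σ[ n ] (λ w → A 1 x w * profile 1)        ≈⟨ Σ-cong (λ w → A-support 1 x w (λ e → reflexive (≡.cong profile (≡.trans (dist-sym w x) e)))) ⟨
    Σ[ n ] (λ w → A 1 x w * profile (∂ w x))  ≈⟨ eigen-row x ⟩
    θ j * profile (∂ x x)                     ≈⟨ *-congˡ (reflexive (≡.cong profile (dist-refl x))) ⟩
    θ j * profile 0                           ∎

  shell : ℕ → Fin 3 → ℕ
  shell k t = toℕ t ℕ.+ k

  shell-injective : ∀ k {s t} → shell k s ≡ shell k t → s ≡ t
  shell-injective k e = toℕ-injective (+-cancelʳ-≡ k _ _ e)

  neighbour-profile : ∀ {y k} → ∂ y x ≡ suc k → ∀ w → ∂ y w ≡ 1 →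
    profile (∂ w x) ≈ Σ[ 3 ] (λ t → A (shell k t) x w * profile (shell k t))
  neighbour-profile {y} {k} e w d₁ with neighbour-distance e (dist1⇒adj d₁)
  ... | s , at-s = begin
    profile (∂ w x)                                          ≡⟨ ≡.cong profile (≡.trans (dist-sym w x) at-s) ⟩
    profile (shell k s)                                      ≈⟨ Σ-indicator (shell k) (shell-injective k) profile s ⟨
    Σ[ 3 ] (λ t → ι ⌊ shell k s ≟ shell k t ⌋ * profile (shell k t)) ≡⟨ ≡.cong (λ e → Σ[ 3 ] (λ t → ι ⌊ e ≟ shell k t ⌋ * profile (shell k t))) at-s ⟨
    Σ[ 3 ] (λ t → A (shell k t) x w * profile (shell k t))   ∎

  three-term : ∀ {y k} → ∂ y x ≡ suc k →
    θ j * profile (suc k) ≈ fromℕ (cc p (suc k)) * profile k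
                             + (fromℕ (aa p (suc k)) * profile (suc k) + fromℕ (bb p (suc k)) * profile (suc (suc k)))
  three-term {y} {k} e = begin
    θ j * profile (suc k)      ≡⟨ ≡.cong (λ d → θ j * profile d) e ⟨
    θ j * profile (∂ y x)      ≈⟨ eigen-row y ⟨
    Σ[ n ] (λ w → A 1 y w * profile (∂ w x))
      ≈⟨ Σ-cong (λ w → A-support 1 y w (neighbour-profile e w)) ⟩
    Σ[ n ] (λ w → A 1 y w * Σ[ 3 ] (λ t → A (shell k t) x w * profile (shell k t)))
      ≈⟨ Σ-*-Σ (A 1 y) (λ t → A (shell k t) x) (profile ∘ shell k) ⟩
    Σ[ 3 ] (λ t → Σ[ n ] (λ w → A 1 y w * A (shell k t) x w) * profile (shell k t))
      ≈⟨ Σ-cong {3} (λ t → *-congʳ {profile (shell k t)} (trans (sym (pcount-as-sum y x 1 (shell k t)))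
                                  (reflexive (≡.cong fromℕ (≡.trans (regular y x 1 (shell k t)) (≡.cong (λ d → p d 1 (shell k t)) e)))))) ⟩
    Σ[ 3 ] (λ t → fromℕ (p (suc k) 1 (shell k t)) * profile (shell k t))
      ≈⟨ +-congˡ (+-congˡ (+-identityʳ _)) ⟩
    fromℕ (cc p (suc k)) * profile k
      + (fromℕ (aa p (suc k)) * profile (suc k) + fromℕ (bb p (suc k)) * profile (suc (suc k))) ∎

  -- profile k = profile 0 · u_k, proved for two consecutive values at a time
  consecutive : ∀ k → suc k ≤ D → profile k ≈ profile 0 * u k × profile (suc k) ≈ profile 0 * u (suc k)
  consecutive zero 1≤D = sym (*-identityʳ _) , (begin
    profile 1                              ≈⟨ divide (inv k₁) (fromℕ-invertible F (k-positive 1≤D)) first-relation ⟩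
    θ j * profile 0 * inv k₁               ≈⟨ solve 3 (λ t b i → t :* b :* i := b :* (t :* i)) refl (θ j) (profile 0) (inv k₁) ⟩
    profile 0 * (θ j * inv k₁)             ∎)
    where
    k₁ : Carrier
    k₁ = fromℕ (kk p 1)
  consecutive (suc k) le with consecutive k (≤-trans (n≤1+n (suc k)) le)
                           | sphere-nonempty x (≤-trans (n≤1+n (suc k)) le)
  ... | at-k , at-1+k | _ , at-y = at-1+k , (begin
    profile (suc (suc k))                      ≈⟨ divide (inv bₖ) (fromℕ-invertible F (b-positive le)) (three-term-step (three-term at-y) at-k at-1+k) ⟩
    profile 0 * ((θ j - aₖ) * u (suc k) - cₖ * u k) * inv bₖ ≈⟨ *-assoc _ _ _ ⟩
    profile 0 * u (suc (suc k))                ∎)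
    where
    aₖ bₖ cₖ : Carrier
    aₖ = fromℕ (aa p (suc k))
    bₖ = fromℕ (bb p (suc k))
    cₖ = fromℕ (cc p (suc k))

  profile-u : ∀ i → i ≤ D → profile i ≈ profile 0 * u i
  profile-u zero    _   = sym (*-identityʳ _)
  profile-u (suc i) i<D = proj₂ (consecutive i i<D)

  sandwich : ∀ i → Σ[ n ] (λ w → E j x w * Σ[ n ] (λ y → A i w y * E j y x)) ≈ fromℕ (kk p i) * profile i
  sandwich i = begin
    Σ[ n ] (λ w → E j x w * (A i · E j) w x)            ≈⟨ Σ-cong (λ w → *-congˡ (E-commute i w x)) ⟩
    Σ[ n ] (λ w → E j x w * Σ[ n ] (λ y → E j w y * A i y x)) ≈⟨ Σ-*-Σ (E j x) (λ y w → E j w y) (λ y → A i y x) ⟩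
    Σ[ n ] (λ y → (E j · E j) x y * A i y x)            ≈⟨ Σ-cong (λ y → *-congʳ (idem j x y)) ⟩
    Σ[ n ] (λ y → E j x y * A i y x)                    ≈⟨ Σ-cong (λ y → trans (*-comm _ _) (*-cong (A-sym i y x) (E-profile x y))) ⟩
    Σ[ n ] (λ y → A i x y * profile (∂ x y))            ≈⟨ Σ-cong (λ y → A-support i x y (λ e → reflexive (≡.cong profile e))) ⟩
    Σ[ n ] (λ y → A i x y * profile i)                  ≈⟨ Σ-*ʳ {n} (profile i) _ ⟨
    Σ[ n ] (λ y → A i x y) * profile i                  ≈⟨ *-congʳ (row-sum i x) ⟩
    fromℕ (kk p i) * profile i                          ∎

module Products {c ℓ : Level} (R : CommutativeRing c ℓ) (F : LinAlg.FieldChar0 R)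
       {n : ℕ} (adj : Fin n → Fin n → Bool) {D : ℕ} {p : ℕ → ℕ → ℕ → ℕ}
       (drg : IsDRG n adj D p)
       (E : Fin (suc D) → LinAlg.Mat R n) (θ : Fin (suc D) → CommutativeRing.Carrier R)
       (idempotents : LinAlg.PrimIdem R F n adj D E θ)
       (x : Fin n) (i j : Fin (suc D)) {m : ℕ} (rank : LinAlg.HasRank R (E j) m) where
  open CommutativeRing R
  open LinAlg R
  open Scalars R
  open FiniteSums R
  open Matrices R
  open DistanceRegular R adj drg
  open PrimIdem idempotents using (symm)
  open PrimitiveIdempotent R F adj drg E θ idempotents x j
  open import Data.Fin.Properties using (toℕ<n)
  open import Algebra.Properties.Ring ring using (x[y-z]≈xy-xz)
  open import Relation.Binary.Reasoning.Setoid setoid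
  open import Algebra.Solver.Ring.NaturalCoefficients.Default commutativeSemiring
    using (solve; _:+_; _:*_; _:=_; con)

  N K M : Carrier
  N = fromℕ n
  K = fromℕ (kk p (toℕ i))
  M = fromℕ m

  Aᵢ : Mat n
  Aᵢ = A (toℕ i)

  d : Fin n → Carrier
  d y = N * E j x y

  L L′ : Mat n
  L  = Aᵢ · dualMat E x j
  L′ = dualMat E x j · Aᵢ

  L′≈Lᵗ : L′ ≈M (L ᵗ)
  L′≈Lᵗ w y = begin
    L′ w y          ≈⟨ diag-· d Aᵢ w y ⟩
    d w * Aᵢ w y    ≈⟨ *-comm _ _ ⟩
    Aᵢ w y * d w    ≈⟨ *-congʳ (A-sym (toℕ i) w y) ⟩
    Aᵢ y w * d w    ≈⟨ ·-diag Aᵢ d y w ⟨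
    L y w           ∎

  T : Carrier
  T = K * (N * M)

  Σd² : Σ[ n ] (λ y → d y * d y) ≈ N * M
  Σd² = begin
    Σ[ n ] (λ y → d y * d y)                     ≈⟨ Σ-cong (λ y → solve 2 (λ N e → (N :* e) :* (N :* e) := (N :* N) :* (e :* e)) refl N (E j x y)) ⟩
    Σ[ n ] (λ y → (N * N) * (E j x y * E j x y)) ≈⟨ Σ-*ˡ {n} (N * N) _ ⟨
    (N * N) * Σ[ n ] (λ y → E j x y * E j x y)   ≈⟨ *-congˡ row-square ⟩
    (N * N) * E j x x                            ≈⟨ *-assoc N N _ ⟩
    N * (N * E j x x)                            ≈⟨ *-congˡ (trans (*-congˡ (E-diagonal x)) (rank-profile rank)) ⟩
    N * M                                        ∎

  ‖L‖² : ‖ L ‖² ≈ T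
  ‖L‖² = begin
    ‖ L ‖²                                               ≈⟨ ⟨⟩-cong (·-diag Aᵢ d) (·-diag Aᵢ d) ⟩
    Σ² (λ w y → (Aᵢ w y * d y) * (Aᵢ w y * d y))         ≈⟨ Σ²-cong entry ⟩
    Σ[ n ] (λ y → Σ[ n ] (λ w → Aᵢ w y * (d y * d y)))   ≈⟨ Σ-cong (λ y → Σ-*ʳ {n} (d y * d y) _) ⟨
    Σ[ n ] (λ y → Σ[ n ] (λ w → Aᵢ w y) * (d y * d y))   ≈⟨ Σ-cong (λ y → *-congʳ (column-sum (toℕ i) y)) ⟩
    Σ[ n ] (λ y → K * (d y * d y))                       ≈⟨ Σ-*ˡ {n} K _ ⟨
    K * Σ[ n ] (λ y → d y * d y)                         ≈⟨ *-congˡ Σd² ⟩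
    T                                                    ∎
    where
    entry : ∀ w y → (Aᵢ w y * d y) * (Aᵢ w y * d y) ≈ Aᵢ w y * (d y * d y)
    entry w y = trans (solve 2 (λ a e → (a :* e) :* (a :* e) := (a :* a) :* (e :* e)) refl (Aᵢ w y) (d y))
                      (*-congʳ (A-idem (toℕ i) w y))

  ‖L′‖² : ‖ L′ ‖² ≈ T
  ‖L′‖² = trans (⟨⟩-cong L′≈Lᵗ L′≈Lᵗ) (trans (‖ᵗ‖² L) ‖L‖²)

  ⟨L,L′⟩ : ⟨ L , L′ ⟩ ≈ T * u (toℕ i)
  ⟨L,L′⟩ = begin
    ⟨ L , L′ ⟩                                                        ≈⟨ ⟨⟩-cong (·-diag Aᵢ d) (diag-· d Aᵢ) ⟩
    Σ² (λ w y → (Aᵢ w y * d y) * (d w * Aᵢ w y))                      ≈⟨ Σ²-cong entry ⟩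
    Σ[ n ] (λ y → Σ[ n ] (λ w → (N * N) * (E j x w * (Aᵢ w y * E j y x)))) ≈⟨ Σ-comm {n} {n} _ ⟩
    Σ[ n ] (λ w → Σ[ n ] (λ y → (N * N) * (E j x w * (Aᵢ w y * E j y x)))) ≈⟨ Σ-cong (λ w → trans (*-congˡ (Σ-*ˡ {n} (E j x w) _)) (Σ-*ˡ {n} (N * N) _)) ⟨
    Σ[ n ] (λ w → (N * N) * (E j x w * Σ[ n ] (λ y → Aᵢ w y * E j y x))) ≈⟨ Σ-*ˡ {n} (N * N) _ ⟨
    (N * N) * Σ[ n ] (λ w → E j x w * Σ[ n ] (λ y → Aᵢ w y * E j y x))   ≈⟨ *-congˡ (sandwich (toℕ i)) ⟩
    (N * N) * (K * profile (toℕ i))                                   ≈⟨ *-congˡ (*-congˡ (profile-u (toℕ i) (ℕ.s≤s⁻¹ (toℕ<n i)))) ⟩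
    (N * N) * (K * (profile 0 * u (toℕ i)))                           ≈⟨ solve 4 (λ N K e v → (N :* N) :* (K :* (e :* v)) := K :* (N :* (N :* e)) :* v) refl N K (profile 0) (u (toℕ i)) ⟩
    K * (N * (N * profile 0)) * u (toℕ i)                             ≈⟨ *-congʳ (*-congˡ (*-congˡ (rank-profile rank))) ⟩
    T * u (toℕ i)                                                     ∎
    where
    entry : ∀ w y → (Aᵢ w y * d y) * (d w * Aᵢ w y) ≈ (N * N) * (E j x w * (Aᵢ w y * E j y x))
    entry w y = begin
      (Aᵢ w y * d y) * (d w * Aᵢ w y)
        ≈⟨ solve 4 (λ a N e f → (a :* (N :* f)) :* ((N :* e) :* a) := (N :* N) :* (e :* ((a :* a) :* f))) refl (Aᵢ w y) N (E j x w) (E j x y) ⟩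
      (N * N) * (E j x w * ((Aᵢ w y * Aᵢ w y) * E j x y))
        ≈⟨ *-congˡ (*-congˡ (*-cong (A-idem (toℕ i) w y) (symm j x y))) ⟩
      (N * N) * (E j x w * (Aᵢ w y * E j y x)) ∎

  base : Carrier
  base = fromℕ 2 * N * K * M

  double : ∀ z → T * z + T * z ≈ base * z
  double z = trans (solve 4 (λ N K M z → K :* (N :* M) :* z :+ K :* (N :* M) :* z := con 2 :* N :* K :* M :* z) refl N K M z)
                   (*-congʳ (*-congʳ (*-congʳ (*-congʳ (sym fromℕ-2)))))

  orthogonal : ⟨ L ⊕ L′ , L ⊖ L′ ⟩ ≈ 0#
  orthogonal = begin
    ⟨ L ⊕ L′ , L ⊖ L′ ⟩  ≈⟨ ⟨⊕,⊖⟩ L L′ ⟩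
    ‖ L ‖² - ‖ L′ ‖²      ≈⟨ +-cong ‖L‖² (-‿cong ‖L′‖²) ⟩
    T - T                 ≈⟨ -‿inverseʳ T ⟩
    0#                    ∎

  norm-sum : ‖ L ⊕ L′ ‖² ≈ base * (1# + u (toℕ i))
  norm-sum = begin
    ‖ L ⊕ L′ ‖²                                          ≈⟨ ‖⊕‖² L L′ ⟩
    (‖ L ‖² + ‖ L′ ‖²) + (⟨ L , L′ ⟩ + ⟨ L , L′ ⟩)       ≈⟨ +-cong (+-cong ‖L‖² ‖L′‖²) (+-cong ⟨L,L′⟩ ⟨L,L′⟩) ⟩
    (T + T) + (T * u (toℕ i) + T * u (toℕ i))            ≈⟨ +-cong (trans (+-cong (sym (*-identityʳ T)) (sym (*-identityʳ T))) (double 1#)) (double _) ⟩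
    base * 1# + base * u (toℕ i)                         ≈⟨ distribˡ base 1# _ ⟨
    base * (1# + u (toℕ i))                              ∎

  norm-difference : ‖ L ⊖ L′ ‖² ≈ base * (1# - u (toℕ i))
  norm-difference = begin
    ‖ L ⊖ L′ ‖²                                          ≈⟨ ‖⊖‖² L L′ ⟩
    (‖ L ‖² + ‖ L′ ‖²) - (⟨ L , L′ ⟩ + ⟨ L , L′ ⟩)       ≈⟨ +-cong (+-cong ‖L‖² ‖L′‖²) (-‿cong (+-cong ⟨L,L′⟩ ⟨L,L′⟩)) ⟩
    (T + T) - (T * u (toℕ i) + T * u (toℕ i))            ≈⟨ +-cong (trans (+-cong (sym (*-identityʳ T)) (sym (*-identityʳ T))) (double 1#)) (-‿cong (double _)) ⟩
    base * 1# - base * u (toℕ i)                         ≈⟨ x[y-z]≈xy-xz base 1# _ ⟨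
    base * (1# - u (toℕ i))                              ∎

-- Lemma 5.10.

lemma5p10 : ∀ {c ℓ : Level} (R : CommutativeRing c ℓ) (F : LinAlg.FieldChar0 R)
    (n : ℕ) (adj : Fin n → Fin n → Bool) (D : ℕ) (p : ℕ → ℕ → ℕ → ℕ)
    → IsDRG n adj D p → 3 ≤ D
    → (E : Fin (suc D) → LinAlg.Mat R n) (θ : Fin (suc D) → CommutativeRing.Carrier R)
    → LinAlg.PrimIdem R F n adj D E θ
    → (x : Fin n) (i j : Fin (suc D)) (m : ℕ) → LinAlg.HasRank R (E j) m
    → let open CommutativeRing R
          open LinAlg R
          Ai = distMat adj (toℕ i)
          Aj* = dualMat E x j
          P = (Ai · Aj*) ⊕ (Aj* · Ai)
          Q = (Ai · Aj*) ⊖ (Aj* · Ai)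
          u = uPoly F p (toℕ i) (θ j)
          base = fromℕ 2 * fromℕ n * fromℕ (kk p (toℕ i)) * fromℕ m
      in (⟨ P , Q ⟩ ≈ 0#)
         × (‖ P ‖² ≈ base * (1# + u))
         × (‖ Q ‖² ≈ base * (1# - u))
lemma5p10 R F n adj D p drg _ E θ idempotents x i j m rank = orthogonal , norm-sum , norm-difference
  where open Products R F adj drg E θ idempotents x i j rank
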